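{- Let $V\in u\to\mathbb{N}$, $v(n)=\{z\mid z\in u\wedge V(z)=n\}$ and $v'(n)=\{z\mid z\in u\wedge V(z)<n\}$. For $a,b\subseteq u$, if $\forall n\in\mathbb{N}\cdot\, a\cap\overline{b}\cap v(n)\subseteq S(v'(n))$ and $a\cap\overline{b}\subseteq \mathrm{grd}(S)\cap S(a)$, then $a\mapsto b\in\mathcal{L}_{m}$.
   Context: Let $u$ be the state space of an event system (the set of states satisfying its invariant $I$). The events are conjunctive (hence monotonic) set transformers $E_i:\mathbb{P}(u)\to\mathbb{P}(u)$, $i$ ranging over a finite index set $L$, and the system is their bounded choice $S$, i.e. $S(r)=\bigcap_{i\in L}E_i(r)$ for all $r\subseteq u$. For $r\subseteq u$ write $\overline{r}=u-r$; the guard of $S$ is $\mathrm{grd}(S)=\overline{S(\varnothing)}$. The basic relation under minimal progress is $\mathcal{E}_{m}=\{a\mapsto b \mid a\subseteq u\wedge b\subseteq u\wedge a\cap\overline{b}\subseteq S(b)\cap\mathrm{grd}(S)\}$, and the reachability (leads-to) relation $\mathcal{L}_{m}\subseteq\mathbb{P}(u)\times\mathbb{P}(u)$ is the smallest relation that contains $\mathcal{E}_m$, is transitive, and is disjunctive (for every $q\subseteq u$ and family $l\subseteq\mathbb{P}(u)$, if $p\mapsto q\in\mathcal{L}_m$ for all $p\in l$ then $\bigcup l\mapsto q\in\mathcal{L}_m$). -}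

module Defs where

open import Level using (0ℓ)
open import Data.Nat using (ℕ; _<_)
open import Data.Fin using (Fin)
open import Data.Product using (Σ; _×_; ∃)
open import Relation.Binary.PropositionalEquality using (_≡_)
open import Relation.Unary using (Pred; _⊆_; _∩_; _∪_; ∁; ∅; _∈_)

-- The state space u is modelled as a type U; subsets of u are predicates on U.
Subset : Set → Set₁
Subset U = Pred U 0ℓ

Transformer : Set → Set₁
Transformer U = Subset U → Subset U

_≐_ : {U : Set} → Subset U → Subset U → Set
p ≐ q = (p ⊆ q) × (q ⊆ p)

-- Families of subsets are represented as indexed families l : I → Subset U
-- (I : Set), for predicativity reasons.
-- Intersection of a family of subsets.
⋂ : {U I : Set} → (I → Subset U) → Subset U
⋂ l z = ∀ i → l i z

⋃ : {U I : Set} → (I → Subset U) → Subset U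
⋃ l z = ∃ λ i → l i z

-- Conjunctive set transformer: distributes over intersections of
-- nonempty families.
Conjunctive : {U : Set} → Transformer U → Set₁
Conjunctive {U} E = (I : Set) (l : I → Subset U) → I →
  E (⋂ l) ≐ ⋂ (λ i → E (l i))

Choice : {U : Set} {k : ℕ} → (Fin k → Transformer U) → Transformer U
Choice E r z = ∀ i → E i r z

grd : {U : Set} → Transformer U → Subset U
grd S = ∁ (S ∅)

Em : {U : Set} → Transformer U → Subset U → Subset U → Set
Em S a b = (a ∩ ∁ b) ⊆ (S b ∩ grd S)

data Lm {U : Set} (S : Transformer U) : Subset U → Subset U → Set₁ where
  basic : ∀ {a b} → Em S a b → Lm S a b
  trans : ∀ {a b c} → Lm S a b → Lm S b c → Lm S a c
  disj  : ∀ {q} (I : Set) (l : I → Subset U) →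
          (∀ i → Lm S (l i) q) → Lm S (⋃ l) q

-- v(n) and v'(n) for a variant V.
lev : {U : Set} → (U → ℕ) → ℕ → Subset U
lev V n z = V z ≡ n

below : {U : Set} → (U → ℕ) → ℕ → Subset U
below V n z = V z < n

-- Induction on the variant V: the part of a ∩ ∁ b at level n moves in one
-- minimal-progress step into a ∩ v'(n), since conjunctivity combines the two
-- hypotheses; and a ∩ v'(n) lies in b or at a strictly lower level.
-- Constructively "a ⊆ b ∪ (a ∩ ∁ b)" only holds up to double negation, which
-- is all the basic relation needs.
module Submission where

open import Defs
open import Data.Bool using (Bool; true; false; if_then_else_)
open import Data.Empty using (⊥-elim)
open import Data.Fin using (Fin)
open import Data.Nat using (ℕ; _<_)
open import Data.Nat.Induction using (<-rec)
open import Data.Product using (Σ; _,_; proj₂)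
open import Data.Sum using (inj₁; inj₂)
open import Relation.Binary.PropositionalEquality using (refl)
open import Relation.Unary using (_⊆_; _∩_; _∪_; ∁)

∩∁⊆⇒⊆¬¬∪ : {U : Set} {x b w : Subset U} → x ∩ ∁ b ⊆ w → x ⊆ ∁ (∁ (b ∪ w))
∩∁⊆⇒⊆¬¬∪ x∖b⊆w xz ¬b∪w = ¬b∪w (inj₂ (x∖b⊆w (xz , λ bz → ¬b∪w (inj₁ bz))))

-- Transformers need not respect extensional equality of predicates, so binary
-- intersection is taken in the ⋂-form that conjunctivity speaks about.
_⊓_ : {U : Set} → Subset U → Subset U → Subset U
p ⊓ q = ⋂ λ i → if i then p else q

Conjunctive⇒⊓ : {U : Set} {E : Transformer U} → Conjunctive E →
  {p q : Subset U} → E p ∩ E q ⊆ E (p ⊓ q)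
Conjunctive⇒⊓ conj {p} {q} (Ep , Eq) =
  proj₂ (conj Bool (λ i → if i then p else q) true) λ { true → Ep ; false → Eq }

Choice-⊓ : {U : Set} {k : ℕ} {E : Fin k → Transformer U} →
  (∀ i → Conjunctive (E i)) →
  {p q : Subset U} → Choice E p ∩ Choice E q ⊆ Choice E (p ⊓ q)
Choice-⊓ {E = E} conj (Sp , Sq) i = Conjunctive⇒⊓ {E = E i} (conj i) (Sp i , Sq i)

module _ {U : Set} {S : Transformer U} where

  Lm-¬¬⊆ : {x y : Subset U} → x ⊆ ∁ (∁ y) → Lm S x y
  Lm-¬¬⊆ x⊆y = basic λ (xz , ¬yz) → ⊥-elim (x⊆y xz ¬yz)

  Lm-refl : {x : Subset U} → Lm S x x
  Lm-refl = Lm-¬¬⊆ λ xz ¬xz → ¬xz xz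

  Lm-∪ : {x y q : Subset U} → Lm S x q → Lm S y q → Lm S (x ∪ y) q
  Lm-∪ {x} {y} {q} x↦q y↦q = trans (Lm-¬¬⊆ join) (disj Bool branch leads)
    where
    branch : Bool → Subset U
    branch true  = x
    branch false = y
    join : (x ∪ y) ⊆ ∁ (∁ (⋃ branch))
    join (inj₁ xz) ¬z = ¬z (true , xz)
    join (inj₂ yz) ¬z = ¬z (false , yz)
    leads : ∀ i → Lm S (branch i) q
    leads true  = x↦q
    leads false = y↦q

  Lm-¬¬cases : {x y w q : Subset U} → x ⊆ ∁ (∁ (y ∪ w)) →
    Lm S y q → Lm S w q → Lm S x q
  Lm-¬¬cases x⊆y∪w y↦q w↦q = trans (Lm-¬¬⊆ x⊆y∪w) (Lm-∪ y↦q w↦q)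

  Lm-variant : (∀ {p q} → S p ∩ S q ⊆ S (p ⊓ q)) →
    (V : U → ℕ) (a b : Subset U) →
    (∀ n → (a ∩ ∁ b ∩ lev V n) ⊆ S (below V n)) →
    (a ∩ ∁ b) ⊆ (grd S ∩ S a) →
    Lm S a b
  Lm-variant S-⊓ V a b decrease progress =
    Lm-¬¬cases (∩∁⊆⇒⊆¬¬∪ {x = a} some-level) Lm-refl
      (disj ℕ level (<-rec (λ n → Lm S (level n) b) level↦b))
    where
    level : ℕ → Subset U
    level n = a ∩ ∁ b ∩ lev V n

    some-level : a ∩ ∁ b ⊆ ⋃ level
    some-level {z} (az , ¬bz) = V z , az , ¬bz , refl

    level↦b : ∀ n → (∀ {m} → m < n → Lm S (level m) b) → Lm S (level n) b
    level↦b n ih = trans (basic step)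
      (Lm-¬¬cases (∩∁⊆⇒⊆¬¬∪ {x = a ⊓ below V n} lower-level) Lm-refl
        (disj (Σ ℕ (_< n)) lower λ (_ , m<n) → ih m<n))
      where
      lower : Σ ℕ (_< n) → Subset U
      lower (m , _) = level m

      lower-level : (a ⊓ below V n) ∩ ∁ b ⊆ ⋃ lower
      lower-level {z} (a⊓below , ¬bz) = (V z , a⊓below false) , a⊓below true , ¬bz , refl

      step : Em S (level n) (a ⊓ below V n)
      step ((az , ¬bz , Vz≡n) , _) =
        let (enabled , Sa) = progress (az , ¬bz)
        in S-⊓ (Sa , decrease n (az , ¬bz , Vz≡n)) , enabled

mainTheorem6 : {U : Set} {k : ℕ} (E : Fin k → Transformer U) →
    (∀ i → Conjunctive (E i)) →
    (V : U → ℕ) (a b : Subset U) →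
    (∀ n → (a ∩ ∁ b ∩ lev V n) ⊆ Choice E (below V n)) →
    (a ∩ ∁ b) ⊆ (grd (Choice E) ∩ Choice E a) →
    Lm (Choice E) a b
mainTheorem6 E conj = Lm-variant (Choice-⊓ {E = E} conj)
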